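{- For all typing contexts $\Gamma$, variables $x$, types $A_1,A_2,B$ and $\lambda$-terms $M$: $\Gamma,x:A_1\cap A_2\vdash_s M:B$ is derivable in $\Lambda_\cap^s$ if and only if $\Gamma,x:A_1,x:A_2\vdash_s M:B$ is derivable in $\Lambda_\cap^s$.
   Context: $\lambda$-terms: $M::=x\mid MM\mid\lambda x.M$ modulo $\alpha$-conversion; $M[x:=N]$ capture-avoiding substitution. Types: $A::=\varphi\mid A\to A\mid A\cap A$. A typing context is a finite set of pairs $x:A$, where a variable may occur with several types; $\Gamma,x:A$ denotes $\Gamma\cup\{x:A\}$; $x\notin\Gamma$ means no $x:B$ lies in $\Gamma$. Rules of $\Lambda_\cap^s$ ($n\ge0$): (Ax) $\Gamma,x:A\vdash_s x:A$; $(\mathsf{Beta})^s$ from $\Gamma\vdash_s M[x:=N]N_1\dots N_n:A$ and $\Gamma\vdash_s N:B$ infer $\Gamma\vdash_s(\lambda x.M)NN_1\dots N_n:A$; $(\mathsf{L}\to)$ from $\Gamma\vdash_s N:A_1$ and $\Gamma,y:A_2\vdash_s yN_1\dots N_n:B$, with $y\notin FV(N_1)\cup\dots\cup FV(N_n)$, $y\notin\Gamma$, infer $\Gamma,x:A_1\to A_2\vdash_s xNN_1\dots N_n:B$; $(\mathsf{R}\to)$ from $\Gamma,x:A\vdash_s M:B$, $x\notin\Gamma$, infer $\Gamma\vdash_s\lambda x.M:A\to B$; $(\mathsf{L}\cap)$ from $\Gamma,x:A_1,x:A_2\vdash_s xN_1\dots N_n:B$ infer $\Gamma,x:A_1\cap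 A_2\vdash_s xN_1\dots N_n:B$; $(\mathsf{R}\cap)$ from $\Gamma\vdash_s M:A$ and $\Gamma\vdash_s M:B$ infer $\Gamma\vdash_s M:A\cap B$. -}

module Defs where

open import Data.Nat using (ℕ; zero; suc; _≟_)
open import Data.List using (List; []; _∷_; _++_; foldl)
open import Data.List.Relation.Unary.All using (All)
open import Data.List.Membership.Propositional using (_∈_)
open import Data.Product using (_×_; _,_; Σ)
open import Relation.Nullary using (¬_; yes; no)

Var : Set
Var = ℕ

data Ty : Set where
  tvar : ℕ → Ty
  _⇒_  : Ty → Ty → Ty
  _∧_  : Ty → Ty → Ty

-- λ-terms modulo α-conversion, in the locally nameless representation:
-- bound variables are de Bruijn indices, free variables are names.
-- Genuine λ-terms are the locally closed ones (predicate LC below).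
data Tm : Set where
  bvar : ℕ → Tm
  fvar : Var → Tm
  app  : Tm → Tm → Tm
  lam  : Tm → Tm

fv : Tm → List Var
fv (bvar _)  = []
fv (fvar x)  = x ∷ []
fv (app t u) = fv t ++ fv u
fv (lam t)   = fv t

openRec : ℕ → Tm → Tm → Tm
openRec k u (bvar i) with k ≟ i
... | yes _ = u
... | no  _ = bvar i
openRec k u (fvar x)  = fvar x
openRec k u (app t s) = app (openRec k u t) (openRec k u s)
openRec k u (lam t)   = lam (openRec (suc k) u t)

-- t ^ u : body t of an abstraction instantiated with u.
-- For the named term λx.M, (M-body ^ N) is  M[x:=N]  (capture-avoiding).
_^_ : Tm → Tm → Tm
t ^ u = openRec 0 u t

data LC : Tm → Set where
  lc-var : ∀ x → LC (fvar x)
  lc-app : ∀ {t u} → LC t → LC u → LC (app t u)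
  lc-lam : ∀ {t} x → ¬ (x ∈ fv t) → LC (t ^ fvar x) → LC (lam t)

apps : Tm → List Tm → Tm
apps = foldl app

-- Typing contexts: finite sets of pairs x:A, represented by lists,
-- with only membership mattering.
Ctx : Set
Ctx = List (Var × Ty)

_≈_ : Ctx → Ctx → Set
Γ ≈ Δ = ∀ p → (p ∈ Γ → p ∈ Δ) × (p ∈ Δ → p ∈ Γ)

_∉ctx_ : Var → Ctx → Set
x ∉ctx Γ = ∀ B → ¬ ((x , B) ∈ Γ)

-- The system Λ∩ˢ.  A conclusion context written "Γ, x:A" in the paper
-- (i.e. Γ ∪ {x:A}) is any Δ with Δ ≈ (x , A) ∷ Γ.
data _⊢s_∶_ : Ctx → Tm → Ty → Set where
  Ax   : ∀ {Δ x A} → (x , A) ∈ Δ → Δ ⊢s fvar x ∶ A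
  Beta : ∀ {Γ M N Ns A B} →
         Γ ⊢s apps (M ^ N) Ns ∶ A → Γ ⊢s N ∶ B →
         Γ ⊢s apps (app (lam M) N) Ns ∶ A
  L⇒   : ∀ {Δ Γ x y N Ns A₁ A₂ B} →
         Δ ≈ ((x , A₁ ⇒ A₂) ∷ Γ) →
         Γ ⊢s N ∶ A₁ →
         ((y , A₂) ∷ Γ) ⊢s apps (fvar y) Ns ∶ B →
         All (λ Nᵢ → ¬ (y ∈ fv Nᵢ)) Ns →
         y ∉ctx Γ →
         Δ ⊢s apps (fvar x) (N ∷ Ns) ∶ B
  R⇒   : ∀ {Γ x M A B} →
         ((x , A) ∷ Γ) ⊢s (M ^ fvar x) ∶ B →
         x ∉ctx Γ →
         ¬ (x ∈ fv M) →
         Γ ⊢s lam M ∶ (A ⇒ B)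
  L∧   : ∀ {Δ Γ x Ns A₁ A₂ B} →
         Δ ≈ ((x , A₁ ∧ A₂) ∷ Γ) →
         ((x , A₁) ∷ (x , A₂) ∷ Γ) ⊢s apps (fvar x) Ns ∶ B →
         Δ ⊢s apps (fvar x) Ns ∶ B
  R∧   : ∀ {Γ M A B} → Γ ⊢s M ∶ A → Γ ⊢s M ∶ B → Γ ⊢s M ∶ (A ∧ B)

-- Both directions are instances of one admissibility statement. Call two
-- contexts equivalent when each pair of one is present in the other up to
-- replacing x:A₁∩A₂ by the two pairs x:A₁, x:A₂ or conversely; derivations
-- then transport along equivalent contexts, by induction on the derivation.
-- Equivalent contexts declare the same variables, so the freshness side
-- conditions survive.  Axioms are repaired by one (L∩) or (R∩); a left rule
-- at x whose target context still holds x:A₁∩A₂ is preceded by an (L∩) on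
-- that pair, after which the principal pair can be split off the target.
module Submission where

open import Defs
open import Level using (0ℓ)
open import Data.Nat using () renaming (_≟_ to _≟ℕ_)
open import Data.List using ([]; _∷_; filter)
open import Data.List.Relation.Unary.Any using (here; there)
open import Data.List.Membership.Propositional using (_∈_; _∉_)
open import Data.List.Membership.Propositional.Properties using (∈-filter⁺; ∈-filter⁻)
open import Data.Product using (_×_; _,_; proj₁; proj₂)
open import Data.Product.Properties using (≡-dec)
open import Data.Sum using (_⊎_; inj₁; inj₂)
open import Data.Empty using (⊥-elim)
open import Relation.Nullary using (¬_; yes; no)
open import Relation.Nullary.Decidable using (_×-dec_; _⊎-dec_; ¬?)
open import Relation.Unary using (Pred; Decidable)
open import Relation.Binary.PropositionalEquality using (_≡_; _≢_; refl; sym; cong)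
open import Relation.Binary.Definitions using (DecidableEquality)

_≟ᵗ_ : DecidableEquality Ty
tvar a ≟ᵗ tvar b with a ≟ℕ b
... | yes refl = yes refl
... | no a≢b   = no λ { refl → a≢b refl }
(A ⇒ B) ≟ᵗ (C ⇒ D) with A ≟ᵗ C | B ≟ᵗ D
... | yes refl | yes refl = yes refl
... | no A≢C   | _        = no λ { refl → A≢C refl }
... | _        | no B≢D   = no λ { refl → B≢D refl }
(A ∧ B) ≟ᵗ (C ∧ D) with A ≟ᵗ C | B ≟ᵗ D
... | yes refl | yes refl = yes refl
... | no A≢C   | _        = no λ { refl → A≢C refl }
... | _        | no B≢D   = no λ { refl → B≢D refl }
tvar _  ≟ᵗ (_ ⇒ _) = no λ ()
tvar _  ≟ᵗ (_ ∧ _) = no λ ()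
(_ ⇒ _) ≟ᵗ tvar _  = no λ ()
(_ ⇒ _) ≟ᵗ (_ ∧ _) = no λ ()
(_ ∧ _) ≟ᵗ tvar _  = no λ ()
(_ ∧ _) ≟ᵗ (_ ⇒ _) = no λ ()

∧≢ˡ : ∀ {A B} → A ∧ B ≢ A
∧≢ˡ ()

∧≢ʳ : ∀ {A B} → A ∧ B ≢ B
∧≢ʳ ()

_≟ᵃ_ : DecidableEquality (Var × Ty)
_≟ᵃ_ = ≡-dec _≟ℕ_ _≟ᵗ_

open import Data.List.Membership.DecPropositional _≟ᵃ_ using (_∈?_)

≈-absorb : ∀ {Γ p} → p ∈ Γ → Γ ≈ (p ∷ Γ)
≈-absorb p∈Γ q = there , λ { (here refl) → p∈Γ ; (there q∈Γ) → q∈Γ }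

≈-∷-filter : ∀ {P : Pred (Var × Ty) 0ℓ} (P? : Decidable P) {Γ p} → p ∈ Γ →
             (∀ {q} → q ∈ Γ → q ≢ p → P q) → Γ ≈ (p ∷ filter P? Γ)
≈-∷-filter P? {Γ} {p} p∈Γ others q = to , from
  where
  to : q ∈ Γ → q ∈ (p ∷ filter P? Γ)
  to q∈Γ with q ≟ᵃ p
  ... | yes refl = here refl
  ... | no q≢p   = there (∈-filter⁺ P? q∈Γ (others q∈Γ q≢p))
  from : q ∈ (p ∷ filter P? Γ) → q ∈ Γ
  from (here refl)  = p∈Γ
  from (there q∈Γ') = proj₁ (∈-filter⁻ P? {xs = Γ} q∈Γ')

module Splitting (x : Var) (A₁ A₂ : Ty) where

  joint part₁ part₂ : Var × Ty
  joint = x , A₁ ∧ A₂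
  part₁ = x , A₁
  part₂ = x , A₂

  IsPart : Var × Ty → Set
  IsPart p = p ≡ part₁ ⊎ p ≡ part₂

  joint-not-part : ¬ IsPart joint
  joint-not-part (inj₁ e) = ∧≢ˡ (cong proj₂ e)
  joint-not-part (inj₂ e) = ∧≢ʳ (cong proj₂ e)

  Covered : Ctx → Var × Ty → Set
  Covered Γ p = p ∈ Γ ⊎ (IsPart p × joint ∈ Γ) ⊎ (p ≡ joint × part₁ ∈ Γ × part₂ ∈ Γ)

  covered? : ∀ Γ → Decidable (Covered Γ)
  covered? Γ p = (p ∈? Γ)
    ⊎-dec (((p ≟ᵃ part₁) ⊎-dec (p ≟ᵃ part₂)) ×-dec (joint ∈? Γ))
    ⊎-dec ((p ≟ᵃ joint) ×-dec (part₁ ∈? Γ) ×-dec (part₂ ∈? Γ))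

  covered-mono : ∀ {Γ Γ′} → (∀ {q} → q ∈ Γ → q ∈ Γ′) → ∀ {p} → Covered Γ p → Covered Γ′ p
  covered-mono f (inj₁ p∈)                   = inj₁ (f p∈)
  covered-mono f (inj₂ (inj₁ (part , j∈)))   = inj₂ (inj₁ (part , f j∈))
  covered-mono f (inj₂ (inj₂ (e , ∈₁ , ∈₂))) = inj₂ (inj₂ (e , f ∈₁ , f ∈₂))

  ∉ctx-covered : ∀ {Γ y B} → y ∉ctx Γ → ¬ Covered Γ (y , B)
  ∉ctx-covered y∉ (inj₁ p∈)                      = y∉ _ p∈
  ∉ctx-covered y∉ (inj₂ (inj₁ (inj₁ refl , j∈))) = y∉ _ j∈
  ∉ctx-covered y∉ (inj₂ (inj₁ (inj₂ refl , j∈))) = y∉ _ j∈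
  ∉ctx-covered y∉ (inj₂ (inj₂ (refl , ∈₁ , _)))  = y∉ _ ∈₁

  infix 4 _≼_ _∼_

  _≼_ : Ctx → Ctx → Set
  Δ ≼ T = ∀ {p} → p ∈ Δ → Covered T p

  _∼_ : Ctx → Ctx → Set
  Δ ∼ T = Δ ≼ T × T ≼ Δ

  ∼-sym : ∀ {Δ T} → Δ ∼ T → T ∼ Δ
  ∼-sym (Δ≼T , T≼Δ) = T≼Δ , Δ≼T

  ≼-∷ : ∀ {Δ T} q → Δ ≼ T → (q ∷ Δ) ≼ (q ∷ T)
  ≼-∷ q Δ≼T (here refl) = inj₁ (here refl)
  ≼-∷ q Δ≼T (there p∈)  = covered-mono there (Δ≼T p∈)

  ∼-∷ : ∀ {Δ T} q → Δ ∼ T → (q ∷ Δ) ∼ (q ∷ T)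
  ∼-∷ q (Δ≼T , T≼Δ) = ≼-∷ q Δ≼T , ≼-∷ q T≼Δ

  ∉ctx-∼ : ∀ {Δ T y} → y ∉ctx Δ → Δ ∼ T → y ∉ctx T
  ∉ctx-∼ y∉ (_ , T≼Δ) B p∈ = ∉ctx-covered y∉ (T≼Δ p∈)

  joint∷-∼-parts∷ : ∀ Γ → (joint ∷ Γ) ∼ (part₁ ∷ part₂ ∷ Γ)
  joint∷-∼-parts∷ Γ = joined≼split , split≼joined
    where
    joined≼split : (joint ∷ Γ) ≼ (part₁ ∷ part₂ ∷ Γ)
    joined≼split (here refl) = inj₂ (inj₂ (refl , here refl , there (here refl)))
    joined≼split (there p∈)  = inj₁ (there (there p∈))
    split≼joined : (part₁ ∷ part₂ ∷ Γ) ≼ (joint ∷ Γ)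
    split≼joined (here refl)         = inj₂ (inj₁ (inj₁ refl , here refl))
    split≼joined (there (here refl)) = inj₂ (inj₁ (inj₂ refl , here refl))
    split≼joined (there (there p∈))  = inj₁ (there p∈)

  ≢joint? : Decidable (_≢ joint)
  ≢joint? q = ¬? (q ≟ᵃ joint)

  dropJoint : Ctx → Ctx
  dropJoint T = filter ≢joint? T

  split : Ctx → Ctx
  split T = part₁ ∷ part₂ ∷ dropJoint T

  ≈-joint∷ : ∀ {T} → joint ∈ T → T ≈ (joint ∷ dropJoint T)
  ≈-joint∷ j∈ = ≈-∷-filter ≢joint? j∈ (λ _ q≢j → q≢j)

  joint∉split : ∀ {T} → joint ∉ split T
  joint∉split (here e)               = joint-not-part (inj₁ e)
  joint∉split (there (here e))       = joint-not-part (inj₂ e)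
  joint∉split {T} (there (there j∈)) = proj₂ (∈-filter⁻ ≢joint? {xs = T} j∈) refl

  ∼-split : ∀ {Δ T} → Δ ∼ T → joint ∈ T → Δ ∼ split T
  ∼-split {Δ} {T} (Δ≼T , T≼Δ) j∈T = Δ≼split , split≼Δ
    where
    Δ≼split : Δ ≼ split T
    Δ≼split {p} p∈Δ with Δ≼T p∈Δ
    ... | inj₁ p∈T with p ≟ᵃ joint
    ...   | yes refl = inj₂ (inj₂ (refl , here refl , there (here refl)))
    ...   | no p≢j   = inj₁ (there (there (∈-filter⁺ ≢joint? p∈T p≢j)))
    Δ≼split p∈Δ | inj₂ (inj₁ (inj₁ refl , _)) = inj₁ (here refl)
    Δ≼split p∈Δ | inj₂ (inj₁ (inj₂ refl , _)) = inj₁ (there (here refl))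
    Δ≼split p∈Δ | inj₂ (inj₂ (refl , _))      = inj₂ (inj₂ (refl , here refl , there (here refl)))
    part-covered : ∀ {p} → IsPart p → Covered Δ p
    part-covered part with T≼Δ j∈T
    ... | inj₁ j∈Δ                  = inj₂ (inj₁ (part , j∈Δ))
    ... | inj₂ (inj₁ (part-j , _))  = ⊥-elim (joint-not-part part-j)
    ... | inj₂ (inj₂ (_ , ∈₁ , ∈₂)) with part
    ...   | inj₁ refl = inj₁ ∈₁
    ...   | inj₂ refl = inj₁ ∈₂
    split≼Δ : split T ≼ Δ
    split≼Δ (here refl)         = part-covered (inj₁ refl)
    split≼Δ (there (here refl)) = part-covered (inj₂ refl)
    split≼Δ (there (there p∈))  = T≼Δ (proj₁ (∈-filter⁻ ≢joint? {xs = T} p∈))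

  restrict : Ctx → Ctx → Ctx
  restrict Γ T = filter (covered? Γ) T

  ∉ctx-restrict : ∀ {Γ T y} → y ∉ctx Γ → y ∉ctx restrict Γ T
  ∉ctx-restrict {Γ} {T} y∉ B p∈ = ∉ctx-covered y∉ (proj₂ (∈-filter⁻ (covered? Γ) {xs = T} p∈))

  -- Without the last hypothesis a principal part x:Aᵢ need not lie in T,
  -- which may hold only the joint.
  ∼-principal : ∀ {Δ Γ T P} → Δ ≈ (P ∷ Γ) → Δ ∼ T → P ≢ joint →
                (joint ∈ T → proj₁ P ≢ x) → T ≈ (P ∷ restrict Γ T) × Γ ∼ restrict Γ T
  ∼-principal {Δ} {Γ} {T} {P} Δ≈ (Δ≼T , T≼Δ) P≢j clear = T≈ , Γ≼ , ≼Γ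
    where
    ∈Γ : ∀ {q} → q ∈ Δ → q ≢ P → q ∈ Γ
    ∈Γ q∈Δ q≢P with proj₁ (Δ≈ _) q∈Δ
    ... | here e    = ⊥-elim (q≢P e)
    ... | there q∈Γ = q∈Γ
    part≢P : joint ∈ T → ∀ {q} → IsPart q → q ≢ P
    part≢P j∈T (inj₁ refl) refl = clear j∈T refl
    part≢P j∈T (inj₂ refl) refl = clear j∈T refl
    P∈T : P ∈ T
    P∈T with Δ≼T (proj₂ (Δ≈ P) (here refl))
    ... | inj₁ P∈T                 = P∈T
    ... | inj₂ (inj₁ (part , j∈T)) = ⊥-elim (part≢P j∈T part refl)
    ... | inj₂ (inj₂ (P≡j , _))    = ⊥-elim (P≢j P≡j)
    covered-Γ : ∀ {q} → q ∈ T → q ≢ P → Covered Γ q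
    covered-Γ q∈T q≢P with T≼Δ q∈T
    ... | inj₁ q∈Δ                 = inj₁ (∈Γ q∈Δ q≢P)
    ... | inj₂ (inj₁ (part , j∈Δ)) = inj₂ (inj₁ (part , ∈Γ j∈Δ (λ j≡P → P≢j (sym j≡P))))
    ... | inj₂ (inj₂ (refl , ∈₁ , ∈₂)) =
          inj₂ (inj₂ (refl , ∈Γ ∈₁ (part≢P q∈T (inj₁ refl)) , ∈Γ ∈₂ (part≢P q∈T (inj₂ refl))))
    T≈ : T ≈ (P ∷ restrict Γ T)
    T≈ = ≈-∷-filter (covered? Γ) P∈T covered-Γ
    ∈restrict : ∀ {q} → q ∈ T → Covered Γ q → q ∈ restrict Γ T
    ∈restrict = ∈-filter⁺ (covered? Γ)
    Γ≼ : Γ ≼ restrict Γ T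
    Γ≼ {p} p∈Γ with Δ≼T (proj₂ (Δ≈ p) (there p∈Γ))
    ... | inj₁ p∈T = inj₁ (∈restrict p∈T (inj₁ p∈Γ))
    ... | inj₂ (inj₁ (part , j∈T)) =
          inj₂ (inj₁ (part , ∈restrict j∈T (covered-Γ j∈T (λ j≡P → P≢j (sym j≡P)))))
    ... | inj₂ (inj₂ (refl , ∈₁ , ∈₂)) =
          inj₂ (inj₂ (refl , ∈restrict ∈₁ (inj₂ (inj₁ (inj₁ refl , p∈Γ)))
                           , ∈restrict ∈₂ (inj₂ (inj₁ (inj₂ refl , p∈Γ)))))
    ≼Γ : restrict Γ T ≼ Γ
    ≼Γ p∈ = proj₂ (∈-filter⁻ (covered? Γ) {xs = T} p∈)

  ∼-unfold-joint : ∀ {Δ Γ T} → Δ ≈ (joint ∷ Γ) → Δ ∼ T → joint ∉ T → (part₁ ∷ part₂ ∷ Γ) ∼ T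
  ∼-unfold-joint {Δ} {Γ} {T} Δ≈ (Δ≼T , T≼Δ) j∉T = parts≼T , T≼parts
    where
    parts∈T : part₁ ∈ T × part₂ ∈ T
    parts∈T with Δ≼T (proj₂ (Δ≈ joint) (here refl))
    ... | inj₁ j∈T                  = ⊥-elim (j∉T j∈T)
    ... | inj₂ (inj₁ (part-j , _))  = ⊥-elim (joint-not-part part-j)
    ... | inj₂ (inj₂ (_ , ∈₁ , ∈₂)) = ∈₁ , ∈₂
    parts≼T : (part₁ ∷ part₂ ∷ Γ) ≼ T
    parts≼T (here refl)         = inj₁ (proj₁ parts∈T)
    parts≼T (there (here refl)) = inj₁ (proj₂ parts∈T)
    parts≼T (there (there p∈Γ)) = Δ≼T (proj₂ (Δ≈ _) (there p∈Γ))
    T≼parts : T ≼ (part₁ ∷ part₂ ∷ Γ)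
    T≼parts {p} p∈T with T≼Δ p∈T
    ... | inj₁ p∈Δ with proj₁ (Δ≈ p) p∈Δ
    ...   | here refl = ⊥-elim (j∉T p∈T)
    ...   | there p∈Γ = inj₁ (there (there p∈Γ))
    T≼parts p∈T | inj₂ (inj₁ (inj₁ refl , _)) = inj₁ (here refl)
    T≼parts p∈T | inj₂ (inj₁ (inj₂ refl , _)) = inj₁ (there (here refl))
    T≼parts p∈T | inj₂ (inj₂ (refl , _))      = ⊥-elim (j∉T p∈T)

  byLeftRule : ∀ {Δ z Ns B} →
               (∀ {T} → Δ ∼ T → (joint ∈ T → z ≢ x) → T ⊢s apps (fvar z) Ns ∶ B) →
               ∀ {T} → Δ ∼ T → T ⊢s apps (fvar z) Ns ∶ B
  byLeftRule {z = z} {Ns} derive {T} Δ∼T with z ≟ℕ x | joint ∈? T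
  ... | no z≢x   | _       = derive Δ∼T (λ _ → z≢x)
  ... | yes _    | no j∉T  = derive Δ∼T (λ j∈T → ⊥-elim (j∉T j∈T))
  ... | yes refl | yes j∈T =
        L∧ {Ns = Ns} (≈-joint∷ j∈T) (derive (∼-split Δ∼T j∈T) (λ j∈ → ⊥-elim (joint∉split {T} j∈)))

  ⊢-resp-∼ : ∀ {Δ T M B} → Δ ∼ T → Δ ⊢s M ∶ B → T ⊢s M ∶ B
  ⊢-resp-∼ Δ∼T (Ax p∈Δ) with proj₁ Δ∼T p∈Δ
  ... | inj₁ p∈T                      = Ax p∈T
  ... | inj₂ (inj₁ (inj₁ refl , j∈T)) = L∧ {Ns = []} (≈-absorb j∈T) (Ax (here refl))
  ... | inj₂ (inj₁ (inj₂ refl , j∈T)) = L∧ {Ns = []} (≈-absorb j∈T) (Ax (there (here refl)))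
  ... | inj₂ (inj₂ (refl , ∈₁ , ∈₂))  = R∧ (Ax ∈₁) (Ax ∈₂)
  ⊢-resp-∼ Δ∼T (Beta {M = M} {Ns = Ns} d e) = Beta {M = M} {Ns = Ns} (⊢-resp-∼ Δ∼T d) (⊢-resp-∼ Δ∼T e)
  ⊢-resp-∼ Δ∼T (R⇒ d x∉ x∉fv) = R⇒ (⊢-resp-∼ (∼-∷ _ Δ∼T) d) (∉ctx-∼ x∉ Δ∼T) x∉fv
  ⊢-resp-∼ Δ∼T (R∧ d e)       = R∧ (⊢-resp-∼ Δ∼T d) (⊢-resp-∼ Δ∼T e)
  ⊢-resp-∼ {Δ} {B = B} Δ∼T (L⇒ {x = z} {N = N} {Ns = Ns} Δ≈ dN dy y∉fv y∉) =
    byLeftRule {Ns = N ∷ Ns} derive Δ∼T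
    where
    derive : ∀ {T} → Δ ∼ T → (joint ∈ T → z ≢ x) → T ⊢s apps (fvar z) (N ∷ Ns) ∶ B
    derive {T} Δ∼T′ clear with ∼-principal Δ≈ Δ∼T′ (λ ()) clear
    ... | T≈ , Γ∼ = L⇒ T≈ (⊢-resp-∼ Γ∼ dN) (⊢-resp-∼ (∼-∷ _ Γ∼) dy) y∉fv (∉ctx-restrict {T = T} y∉)
  ⊢-resp-∼ {Δ} {B = B} Δ∼T (L∧ {x = z} {Ns = Ns} {A₁ = C₁} {A₂ = C₂} Δ≈ d) =
    byLeftRule {Ns = Ns} derive Δ∼T
    where
    derive : ∀ {T} → Δ ∼ T → (joint ∈ T → z ≢ x) → T ⊢s apps (fvar z) Ns ∶ B
    derive Δ∼T′ clear with (z , C₁ ∧ C₂) ≟ᵃ joint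
    ... | yes refl = ⊢-resp-∼ (∼-unfold-joint Δ≈ Δ∼T′ (λ j∈T → clear j∈T refl)) d
    ... | no P≢j with ∼-principal Δ≈ Δ∼T′ P≢j clear
    ...   | T≈ , Γ∼ = L∧ {Ns = Ns} T≈ (⊢-resp-∼ (∼-∷ _ (∼-∷ _ Γ∼)) d)

proposition1 : ∀ (Γ : Ctx) (x : Var) (A₁ A₂ B : Ty) (M : Tm) → LC M →
    (((x , A₁ ∧ A₂) ∷ Γ) ⊢s M ∶ B → ((x , A₁) ∷ (x , A₂) ∷ Γ) ⊢s M ∶ B)
    × (((x , A₁) ∷ (x , A₂) ∷ Γ) ⊢s M ∶ B → ((x , A₁ ∧ A₂) ∷ Γ) ⊢s M ∶ B)
proposition1 Γ x A₁ A₂ B M _ =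
  ⊢-resp-∼ (joint∷-∼-parts∷ Γ) , ⊢-resp-∼ (∼-sym (joint∷-∼-parts∷ Γ))
  where open Splitting x A₁ A₂
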